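{- Let $n\ge 3$, $K\subseteq\{2,\ldots,n-1\}$, and let $S_K$ and $\mathcal{D}(S_K)$ be as defined in the context. Then: (i) if $a$ is a black bead of $S_K$, then for every triple $\{a,b,c\}\subseteq[n]$ with $b<a<c$, no order of $\mathcal{D}(S_K)$ ranks $a$ first among $\{a,b,c\}$; (ii) if $a$ is a white bead of $S_K$, then for every triple $\{a,b,c\}\subseteq[n]$ with $b<a<c$, no order of $\mathcal{D}(S_K)$ ranks $a$ last among $\{a,b,c\}$.
   Context: $[n]=\{1,\ldots,n\}$. Necklace $S_K$: let $L=\{2,\ldots,n-1\}\setminus K$, with elements $k_1<\cdots<k_s$ of $K$ and $\ell_1<\cdots<\ell_t$ of $L$. Place the numbers $1,\ldots,n$ ("beads") on a circle in the cyclic order $1, k_1,\ldots,k_s, n, \ell_t,\ldots,\ell_1$ (then back to $1$); beads $1,k_1,\ldots,k_s,n$ are white and $\ell_1,\ldots,\ell_t$ are black. A set $X\subseteq[n]$ is $w$-convex if (1) $X$ is an arc (contiguous set) of this circle, (2) $X$ is not a single black bead, and (3) there are no integers $i<j<k$ with $i,k\in X$, $j\notin X$ and $j$ white. A flag of $w$-convex sets is a chain $X_1\subset X_2\subset\cdots\subset X_n=[n]$ of $w$-convex sets with $|X_k|=k$; it defines the linear order $x_1x_2\ldots x_n$ (ranked from top) where $\{x_i\}=X_i\setminus X_{i-1}$, $X_0=\emptyset$. $\mathcal{D}(S_K)$ is the set of all linear orders arising from flags of $w$-convex sets. -}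

module Defs where

open import Data.Nat using (ℕ; zero; suc; _+_; _∸_; _≤_; _<_; _%_)
open import Data.Bool using (Bool; true; false; not)
open import Data.List using (List; []; _∷_; _++_; map; upTo; filterᵇ; reverse; take; length)
open import Data.List.Membership.Propositional using (_∈_)
open import Data.List.Relation.Binary.Permutation.Propositional using (_↭_)
open import Data.Product using (Σ; ∃; _×_; _,_)
open import Data.Sum using (_⊎_)
open import Data.Empty using (⊥)
open import Relation.Nullary using (¬_)
open import Relation.Binary.PropositionalEquality using (_≡_)
open import Function.Bundles using (_⇔_)

range1 : ℕ → List ℕ
range1 n = map suc (upTo n)

inner : ℕ → List ℕ
inner n = map (2 +_) (upTo (n ∸ 2))

-- The set K ⊆ {2,…,n-1} is given by its membership function K : ℕ → Bool;
-- only its values on {2,…,n-1} are relevant.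

White : ℕ → (ℕ → Bool) → ℕ → Set
White n K x = (x ≡ 1) ⊎ (x ≡ n) ⊎ ((2 ≤ x) × (x < n) × (K x ≡ true))

Black : ℕ → (ℕ → Bool) → ℕ → Set
Black n K x = (2 ≤ x) × (x < n) × (K x ≡ false)

-- The necklace as a cyclic list: 1, k_1,…,k_s, n, ℓ_t,…,ℓ_1
circle : ℕ → (ℕ → Bool) → List ℕ
circle n K = 1 ∷ filterᵇ K (inner n) ++ n ∷ reverse (filterᵇ (λ x → not (K x)) (inner n))

-- total indexing with default 0 (only used with in-range indices)
nth : List ℕ → ℕ → ℕ
nth []       _       = 0
nth (x ∷ xs) zero    = x
nth (x ∷ xs) (suc i) = nth xs i

SetP : Set₁
SetP = ℕ → Set

-- (1) X is an arc (contiguous set of consecutive beads) of the circle: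
--     X = { c_{(i + j) mod n} | j < m } for some start i < n and length m ≤ n,
--     where c is the circle list; indices taken in (circle ++ circle) to wrap around.
IsArc : ℕ → (ℕ → Bool) → SetP → Set
IsArc n K X =
  Σ ℕ λ i → Σ ℕ λ m → (i < n) × (m ≤ n) ×
    (∀ y → X y ⇔ (Σ ℕ λ j → (j < m) × (nth (circle n K ++ circle n K) (i + j) ≡ y)))

SingleBlack : ℕ → (ℕ → Bool) → SetP → Set
SingleBlack n K X = Σ ℕ λ b → Black n K b × (∀ y → X y ⇔ (y ≡ b))

NoWhiteGap : ℕ → (ℕ → Bool) → SetP → Set
NoWhiteGap n K X = ∀ i j k → i < j → j < k → X i → X k → ¬ X j → White n K j → ⊥

WConvex : ℕ → (ℕ → Bool) → SetP → Set
WConvex n K X = IsArc n K X × ¬ SingleBlack n K X × NoWhiteGap n K X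

-- D(S_K): linear orders x_1 … x_n (a list, top-ranked first) of [n] arising from
-- a flag X_1 ⊂ … ⊂ X_n = [n] of w-convex sets; X_k is exactly the set of the
-- first k entries of the list, so the order is in D(S_K) iff it is a
-- permutation of [n] all of whose prefix sets X_k (1 ≤ k ≤ n) are w-convex.
InD : ℕ → (ℕ → Bool) → List ℕ → Set
InD n K xs = (xs ↭ range1 n) × (∀ k → 1 ≤ k → k ≤ n → WConvex n K (λ y → y ∈ take k xs))

RanksFirst : List ℕ → ℕ → ℕ → ℕ → Set
RanksFirst xs a b c = Σ (List ℕ) λ ys → Σ (List ℕ) λ zs → (xs ≡ ys ++ a ∷ zs) × (b ∈ zs) × (c ∈ zs)

RanksLast : List ℕ → ℕ → ℕ → ℕ → Set
RanksLast xs a b c = Σ (List ℕ) λ ys → Σ (List ℕ) λ zs → (xs ≡ ys ++ a ∷ zs) × (b ∈ ys) × (c ∈ ys)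

{-# OPTIONS --safe #-}
-- Put the bead x at position x if it is white and at 2n ∸ x if it is black: the necklace
-- 1, k₁, …, kₛ, n, ℓₜ, …, ℓ₁ is then listed in increasing position, and an arc of it cannot
-- contain w, y and miss x, z for beads at positions w < x < y < z, nor the other way round.
-- (ii) The beads ranked above a white a form a w-convex set with the white gap b < a < c.
-- (i) The top bead w is white, since {w} is w-convex.  The beads ranked down to a black a
-- form a w-convex set X containing w and a but neither b nor c.  A white b (resp. c) missing
-- from X must lie below (resp. above) w, as X has no white gap; then the positions of
-- w, a, b, c always interleave X and its complement, so X is not an arc.
module Submission where

open import Defs
open import Data.Nat using (ℕ; zero; suc; _+_; _∸_; _≤_; _<_; z≤n; s≤s; _≟_; _≤?_; _<?_)
open import Data.Nat.Properties
open import Data.Bool using (Bool; true; false; not)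
open import Data.Bool.Properties using (T-≡; T-not-≡)
open import Data.List using (List; []; _∷_; _++_; [_]; upTo; filterᵇ; reverse; take; length)
open import Data.List.Properties using (length-map; length-++; length-upTo; length-reverse; unfold-reverse; ++-assoc)
open import Data.List.Membership.Propositional using (_∈_)
open import Data.List.Membership.Propositional.Properties using (∈-map⁺; ∈-map⁻; ∈-++⁺ˡ; ∈-++⁺ʳ; ∈-++⁻; ∈-upTo⁺; ∈-upTo⁻; ∈-filter⁺; ∈-filter⁻)
open import Data.List.Relation.Unary.Any using (here; there)
import Data.List.Relation.Unary.Any.Properties as Any
open import Data.List.Relation.Unary.All as All using (All; []; _∷_)
open import Data.List.Relation.Unary.AllPairs using (AllPairs; []; _∷_)
import Data.List.Relation.Unary.AllPairs.Properties as AllPairs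
open import Data.List.Relation.Unary.Unique.Propositional using (Unique)
import Data.List.Relation.Unary.Unique.Propositional.Properties as Unique
open import Data.List.Relation.Binary.Permutation.Propositional using (↭-sym; ↭⇒↭ₛ)
open import Data.List.Relation.Binary.Permutation.Propositional.Properties using (∈-resp-↭; ↭-length)
import Data.List.Relation.Binary.Permutation.Setoid.Properties as Permutationₛ
open import Data.Product using (Σ; _×_; _,_; proj₁; proj₂; map₁)
open import Data.Sum using (_⊎_; inj₁; inj₂; [_,_]′)
import Data.Sum as Sum
open import Data.Empty using (⊥; ⊥-elim)
open import Relation.Nullary using (¬_; yes; no; contradiction)
open import Relation.Nullary.Decidable using (T?)
open import Relation.Binary using (tri<; tri≈; tri>)
open import Relation.Binary.PropositionalEquality
  using (_≡_; _≢_; refl; sym; trans; cong; subst; subst₂; setoid; module ≡-Reasoning)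
open import Function using (_∘_; id; flip)
open import Function.Bundles using (_⇔_; mk⇔; Equivalence)

module _ {A : Set} where

  AllPairs-restrict : {P : A → Set} {Q R : A → A → Set} →
    (∀ {x y} → P x → P y → Q x y → R x y) →
    ∀ {xs} → All P xs → AllPairs Q xs → AllPairs R xs
  AllPairs-restrict f []         []         = []
  AllPairs-restrict f (px ∷ pxs) (qx ∷ qxs) =
    All.zipWith (λ (py , q) → f px py q) (pxs , qx) ∷ AllPairs-restrict f pxs qxs

  AllPairs-reverse : {R : A → A → Set} → ∀ {xs} → AllPairs R xs → AllPairs (flip R) (reverse xs)
  AllPairs-reverse {xs = []}     []         = []
  AllPairs-reverse {xs = x ∷ xs} (Rx ∷ Rxs) rewrite unfold-reverse x xs =
    AllPairs.++⁺ (AllPairs-reverse Rxs) ([] ∷ [])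
      (All.tabulate λ y∈ → All.lookup Rx (Any.reverse⁻ y∈) ∷ [])

  Unique-++-disjoint : ∀ xs {ys} {x : A} → Unique (xs ++ ys) → x ∈ xs → ¬ x ∈ ys
  Unique-++-disjoint (_ ∷ xs) (x≢ ∷ _) (here refl) x∈ys = All.lookup x≢ (∈-++⁺ʳ xs x∈ys) refl
  Unique-++-disjoint (_ ∷ xs) (_ ∷ u)  (there x∈)  x∈ys = Unique-++-disjoint xs u x∈ x∈ys

  take-length-++ : ∀ (xs ys : List A) → take (length xs) (xs ++ ys) ≡ xs
  take-length-++ []       ys = refl
  take-length-++ (x ∷ xs) ys = cong (x ∷_) (take-length-++ xs ys)

  ∈⇒1≤length : ∀ {x : A} {xs} → x ∈ xs → 1 ≤ length xs
  ∈⇒1≤length (here _)  = s≤s z≤n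
  ∈⇒1≤length (there _) = s≤s z≤n

  length-filterᵇ-complement : ∀ (p : A → Bool) xs →
    length (filterᵇ p xs) + length (filterᵇ (not ∘ p) xs) ≡ length xs
  length-filterᵇ-complement p []       = refl
  length-filterᵇ-complement p (x ∷ xs) with p x
  ... | true  = cong suc (length-filterᵇ-complement p xs)
  ... | false = trans (+-suc _ _) (cong suc (length-filterᵇ-complement p xs))

nth-++ˡ : ∀ xs ys {t} → t < length xs → nth (xs ++ ys) t ≡ nth xs t
nth-++ˡ (x ∷ xs) ys {zero}  _        = refl
nth-++ˡ (x ∷ xs) ys {suc t} (s≤s t<) = nth-++ˡ xs ys t<

nth-++ʳ : ∀ xs ys t → nth (xs ++ ys) (length xs + t) ≡ nth ys t
nth-++ʳ []       ys t = refl
nth-++ʳ (x ∷ xs) ys t = nth-++ʳ xs ys t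

All-nth : ∀ {P : ℕ → Set} xs → All P xs → ∀ {u} → u < length xs → P (nth xs u)
All-nth (x ∷ xs) (px ∷ _)   {zero}  _        = px
All-nth (x ∷ xs) (_  ∷ pxs) {suc u} (s≤s u<) = All-nth xs pxs u<

AllPairs-nth : ∀ {R : ℕ → ℕ → Set} xs → AllPairs R xs →
  ∀ {t u} → t < u → u < length xs → R (nth xs t) (nth xs u)
AllPairs-nth (x ∷ xs) (Rx ∷ _)   {zero}  {suc u} _          (s≤s u<) = All-nth xs Rx u<
AllPairs-nth (x ∷ xs) (_  ∷ Rxs) {suc t} {suc u} (s≤s t<u) (s≤s u<) = AllPairs-nth xs Rxs t<u u<

indexOf : ℕ → List ℕ → ℕ
indexOf x []       = 0
indexOf x (y ∷ ys) with x ≟ y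
... | yes _ = 0
... | no  _ = suc (indexOf x ys)

indexOf-∈ : ∀ {x} xs → x ∈ xs → indexOf x xs < length xs × nth xs (indexOf x xs) ≡ x
indexOf-∈ {x} (y ∷ ys) x∈ with x ≟ y
indexOf-∈ {x} (y ∷ ys) x∈           | yes x≡y = s≤s z≤n , sym x≡y
indexOf-∈ {x} (y ∷ ys) (here x≡y)   | no x≢y  = contradiction x≡y x≢y
indexOf-∈ {x} (y ∷ ys) (there x∈ys) | no _    = map₁ s≤s (indexOf-∈ ys x∈ys)

InRange : ℕ → ℕ → ℕ → Set
InRange i k t = i ≤ t × t < k

InRange⇒offset : ∀ {i m t} → InRange i (i + m) t → Σ ℕ λ j → j < m × i + j ≡ t
InRange⇒offset {i} {m} {t} (i≤t , t<) =
  t ∸ i , +-cancelˡ-< i (t ∸ i) m (subst (_< i + m) (sym i+[t∸i]≡t) t<) , i+[t∸i]≡t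
  where
  i+[t∸i]≡t : i + (t ∸ i) ≡ t
  i+[t∸i]≡t = m+[n∸m]≡n i≤t

-- For i < n, the index p < n lies on the arc i, i+1, …, i+m-1 (mod n) of the n-cycle.
InArc : ℕ → ℕ → ℕ → ℕ → Set
InArc n i m p = InRange i (i + m) p ⊎ InRange i (i + m) (p + n)

module _ {n i m : ℕ} (i<n : i < n) {p q r s : ℕ}
         (p<q : p < q) (q<r : q < r) (r<s : r < s) (s<n : s < n) where

  private
    <+n : ∀ x → s < x + n
    <+n x = <-≤-trans s<n (m≤n+m n x)

    i≤+n : ∀ x → i ≤ x + n
    i≤+n x = ≤-trans (<⇒≤ i<n) (m≤n+m n x)

    +n-mono : ∀ {x y} → x < y → x + n < y + n
    +n-mono = +-monoˡ-< n

  InArc-interleave₁ : InArc n i m p → InArc n i m r → InArc n i m q ⊎ InArc n i m s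
  InArc-interleave₁ (inj₁ (i≤p , _)) (inj₁ (_ , r<)) =
    inj₁ (inj₁ (≤-trans i≤p (<⇒≤ p<q) , <-trans q<r r<))
  InArc-interleave₁ (inj₁ (i≤p , _)) (inj₂ (_ , r+n<)) =
    inj₂ (inj₁ (≤-trans i≤p (<⇒≤ (<-trans p<q (<-trans q<r r<s))) , <-trans (<+n r) r+n<))
  InArc-interleave₁ (inj₂ (_ , p+n<)) (inj₁ (i≤r , _)) =
    inj₂ (inj₁ (≤-trans i≤r (<⇒≤ r<s) , <-trans (<+n p) p+n<))
  InArc-interleave₁ (inj₂ _) (inj₂ (_ , r+n<)) =
    inj₁ (inj₂ (i≤+n q , <-trans (+n-mono q<r) r+n<))

  InArc-interleave₂ : InArc n i m q → InArc n i m s → InArc n i m p ⊎ InArc n i m r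
  InArc-interleave₂ (inj₁ (i≤q , _)) (inj₁ (_ , s<)) =
    inj₂ (inj₁ (≤-trans i≤q (<⇒≤ q<r) , <-trans r<s s<))
  InArc-interleave₂ (inj₁ _) (inj₂ (_ , s+n<)) =
    inj₁ (inj₂ (i≤+n p , <-trans (+n-mono (<-trans p<q (<-trans q<r r<s))) s+n<))
  InArc-interleave₂ (inj₂ (_ , q+n<)) (inj₁ _) =
    inj₁ (inj₂ (i≤+n p , <-trans (+n-mono p<q) q+n<))
  InArc-interleave₂ (inj₂ _) (inj₂ (_ , s+n<)) =
    inj₂ (inj₂ (i≤+n r , <-trans (+n-mono r<s) s+n<))

length-range1 : ∀ n → length (range1 n) ≡ n
length-range1 n = trans (length-map suc (upTo n)) (length-upTo n)

module _ {n : ℕ} {K : ℕ → Bool} where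

  InD-unique : ∀ {xs} → InD n K xs → Unique xs
  InD-unique (xs↭ , _) =
    Permutationₛ.Unique-resp-↭ (setoid ℕ) (↭⇒↭ₛ (↭-sym xs↭)) (Unique.map⁺ suc-injective (Unique.upTo⁺ n))

  InD-length : ∀ {xs} → InD n K xs → length xs ≡ n
  InD-length (xs↭ , _) = trans (↭-length xs↭) (length-range1 n)

  InD-bounds : ∀ {xs x} → InD n K xs → x ∈ xs → 1 ≤ x × x ≤ n
  InD-bounds (xs↭ , _) x∈ with ∈-map⁻ suc (∈-resp-↭ xs↭ x∈)
  ... | y , y∈ , refl = s≤s z≤n , ∈-upTo⁻ y∈

  prefix-wconvex : ∀ ys {zs} → InD n K (ys ++ zs) → 1 ≤ length ys → WConvex n K (_∈ ys)
  prefix-wconvex ys {zs} D@(_ , convex) 1≤|ys| =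
    subst (λ l → WConvex n K (_∈ l)) (take-length-++ ys zs) (convex (length ys) 1≤|ys| |ys|≤n)
    where
    |ys|≤n : length ys ≤ n
    |ys|≤n = subst (length ys ≤_) (trans (sym (length-++ ys)) (InD-length D)) (m≤m+n _ _)

  singleton-black-not-wconvex : ∀ {x} → Black n K x → ¬ WConvex n K (_∈ [ x ])
  singleton-black-not-wconvex {x} bx (_ , not-single-black , _) =
    not-single-black (x , bx , λ y → mk⇔ (λ { (here y≡x) → y≡x ; (there ()) }) here)

  white-not-last : ∀ {a b c xs} → White n K a → b < a → a < c → InD n K xs → ¬ RanksLast xs a b c
  white-not-last {a} {b} {c} wa b<a a<c D (ys , zs , refl , b∈ys , c∈ys) =
    no-white-gap b a c b<a a<c b∈ys c∈ys a∉ys wa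
    where
    no-white-gap : NoWhiteGap n K (_∈ ys)
    no-white-gap = proj₂ (proj₂ (prefix-wconvex ys D (∈⇒1≤length b∈ys)))

    a∉ys : ¬ a ∈ ys
    a∉ys a∈ys = Unique-++-disjoint ys (InD-unique D) a∈ys (here refl)

module Necklace (n : ℕ) (2≤n : 2 ≤ n) (K : ℕ → Bool) where

  Bead : ℕ → Set
  Bead x = 1 ≤ x × x ≤ n

  S : List ℕ
  S = circle n K

  whites blacks : List ℕ
  whites = filterᵇ K (inner n)
  blacks = filterᵇ (not ∘ K) (inner n)

  white-1 : White n K 1
  white-1 = inj₁ refl

  white-n : White n K n
  white-n = inj₂ (inj₁ refl)

  white⇒bead : ∀ {x} → White n K x → Bead x
  white⇒bead (inj₁ refl)                   = ≤-refl , <⇒≤ 2≤n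
  white⇒bead (inj₂ (inj₁ refl))            = <⇒≤ 2≤n , ≤-refl
  white⇒bead (inj₂ (inj₂ (2≤x , x<n , _))) = <⇒≤ 2≤x , <⇒≤ x<n

  black⇒bead : ∀ {x} → Black n K x → Bead x
  black⇒bead (2≤x , x<n , _) = <⇒≤ 2≤x , <⇒≤ x<n

  bead⇒white⊎black : ∀ {x} → Bead x → White n K x ⊎ Black n K x
  bead⇒white⊎black {x} (1≤x , x≤n) with x ≟ 1 | x ≟ n | K x
  ... | yes x≡1 | _       | _     = inj₁ (inj₁ x≡1)
  ... | no  _   | yes x≡n | _     = inj₁ (inj₂ (inj₁ x≡n))
  ... | no  x≢1 | no  x≢n | true  = inj₁ (inj₂ (inj₂ (≤∧≢⇒< 1≤x (x≢1 ∘ sym) , ≤∧≢⇒< x≤n x≢n , refl)))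
  ... | no  x≢1 | no  x≢n | false = inj₂ (≤∧≢⇒< 1≤x (x≢1 ∘ sym) , ≤∧≢⇒< x≤n x≢n , refl)

  position : ℕ → ℕ
  position x with x ≤? 1 | n ≤? x | K x
  ... | yes _ | _     | _     = x
  ... | no  _ | yes _ | _     = x
  ... | no  _ | no  _ | true  = x
  ... | no  _ | no  _ | false = n + n ∸ x

  position-white : ∀ {x} → White n K x → position x ≡ x
  position-white {x} wx with x ≤? 1 | n ≤? x | K x
  ... | yes _   | _     | _     = refl
  ... | no  _   | yes _ | _     = refl
  ... | no  _   | no  _ | true  = refl
  ... | no  x≰1 | no  n≰x | false with wx
  ...   | inj₁ refl                      = contradiction ≤-refl x≰1
  ...   | inj₂ (inj₁ refl)               = contradiction ≤-refl n≰x
  ...   | inj₂ (inj₂ (_ , _ , ()))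

  position-black : ∀ {x} → Black n K x → position x ≡ n + n ∸ x
  position-black {x} (2≤x , x<n , Kx≡false) with x ≤? 1 | n ≤? x | K x
  ... | yes x≤1 | _     | _     = contradiction (≤-trans 2≤x x≤1) (<-irrefl refl)
  ... | no  _   | yes n≤x | _   = contradiction (<-≤-trans x<n n≤x) (<-irrefl refl)
  ... | no  _   | no  _ | true  = contradiction Kx≡false λ ()
  ... | no  _   | no  _ | false = refl

  _⊏_ : ℕ → ℕ → Set
  x ⊏ y = position x < position y

  white⊏black : ∀ {x y} → White n K x → Black n K y → x ⊏ y
  white⊏black {x} {y} wx by@(_ , y<n , _) rewrite position-white wx | position-black by =
    ≤-<-trans (proj₂ (white⇒bead wx)) (m+n≤o⇒m≤o∸n (suc n) (+-monoʳ-< n y<n))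

  white<⇒⊏ : ∀ {x y} → White n K x → White n K y → x < y → x ⊏ y
  white<⇒⊏ wx wy x<y rewrite position-white wx | position-white wy = x<y

  black<⇒⊐ : ∀ {x y} → Black n K x → Black n K y → x < y → y ⊏ x
  black<⇒⊐ bx by@(_ , y<n , _) x<y rewrite position-black bx | position-black by =
    ∸-monoʳ-< x<y (≤-trans (<⇒≤ y<n) (m≤m+n n n))

  inner-bounds : ∀ {x} → x ∈ inner n → 2 ≤ x × x < n
  inner-bounds x∈ with ∈-map⁻ (2 +_) x∈
  ... | y , y∈ , refl = s≤s (s≤s z≤n) , subst (2 + y <_) (m+[n∸m]≡n 2≤n) (+-monoʳ-< 2 (∈-upTo⁻ y∈))

  ∈inner : ∀ {x} → 2 ≤ x → x < n → x ∈ inner n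
  ∈inner 2≤x x<n =
    subst (_∈ inner n) (m+[n∸m]≡n 2≤x) (∈-map⁺ (2 +_) (∈-upTo⁺ (∸-monoˡ-< x<n 2≤x)))

  inner-sorted : AllPairs _<_ (inner n)
  inner-sorted = AllPairs.map⁺ (AllPairs.applyUpTo⁺₁ id (n ∸ 2) (λ i<j _ → s≤s (s≤s i<j)))

  ∈whites⇒white : ∀ {x} → x ∈ whites → White n K x
  ∈whites⇒white x∈ with ∈-filter⁻ (T? ∘ K) x∈
  ... | x∈inner , Kx with inner-bounds x∈inner
  ...   | 2≤x , x<n = inj₂ (inj₂ (2≤x , x<n , Equivalence.to T-≡ Kx))

  ∈whites⇒<n : ∀ {x} → x ∈ whites → x < n
  ∈whites⇒<n = proj₂ ∘ inner-bounds ∘ proj₁ ∘ ∈-filter⁻ (T? ∘ K)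

  ∈blacks⇒black : ∀ {x} → x ∈ blacks → Black n K x
  ∈blacks⇒black x∈ with ∈-filter⁻ (T? ∘ not ∘ K) x∈
  ... | x∈inner , ¬Kx with inner-bounds x∈inner
  ...   | 2≤x , x<n = 2≤x , x<n , Equivalence.to T-not-≡ ¬Kx

  white∈S : ∀ {x} → White n K x → x ∈ S
  white∈S (inj₁ refl)                      = here refl
  white∈S (inj₂ (inj₁ refl))               = there (∈-++⁺ʳ whites (here refl))
  white∈S (inj₂ (inj₂ (2≤x , x<n , Kx))) =
    there (∈-++⁺ˡ (∈-filter⁺ (T? ∘ K) (∈inner 2≤x x<n) (Equivalence.from T-≡ Kx)))

  black∈S : ∀ {x} → Black n K x → x ∈ S
  black∈S (2≤x , x<n , ¬Kx) = there (∈-++⁺ʳ whites (there (Any.reverse⁺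
    (∈-filter⁺ (T? ∘ not ∘ K) (∈inner 2≤x x<n) (Equivalence.from T-not-≡ ¬Kx)))))

  bead∈S : ∀ {x} → Bead x → x ∈ S
  bead∈S = [ white∈S , black∈S ]′ ∘ bead⇒white⊎black

  S-sorted : AllPairs _⊏_ S
  S-sorted = All.tabulate 1⊏ ∷ AllPairs.++⁺ whites-sorted (All.tabulate n⊏ ∷ blacks-sorted)
                                 (All.tabulate λ x∈ → All.tabulate (whites⊏ x∈))
    where
    whites-sorted : AllPairs _⊏_ whites
    whites-sorted = AllPairs-restrict white<⇒⊏ (All.tabulate ∈whites⇒white)
                      (AllPairs.filter⁺ (T? ∘ K) inner-sorted)

    blacks-sorted : AllPairs _⊏_ (reverse blacks)
    blacks-sorted = AllPairs-restrict (λ by bx x<y → black<⇒⊐ bx by x<y)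
                      (All.tabulate (∈blacks⇒black ∘ Any.reverse⁻))
                      (AllPairs-reverse (AllPairs.filter⁺ (T? ∘ not ∘ K) inner-sorted))

    n⊏ : ∀ {y} → y ∈ reverse blacks → n ⊏ y
    n⊏ = white⊏black white-n ∘ ∈blacks⇒black ∘ Any.reverse⁻

    whites⊏ : ∀ {x y} → x ∈ whites → y ∈ n ∷ reverse blacks → x ⊏ y
    whites⊏ x∈ (here refl) = white<⇒⊏ (∈whites⇒white x∈) white-n (∈whites⇒<n x∈)
    whites⊏ x∈ (there y∈)  = white⊏black (∈whites⇒white x∈) (∈blacks⇒black (Any.reverse⁻ y∈))

    1⊏ : ∀ {y} → y ∈ whites ++ n ∷ reverse blacks → 1 ⊏ y
    1⊏ y∈ with ∈-++⁻ whites y∈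
    ... | inj₁ y∈whites = white<⇒⊏ white-1 (∈whites⇒white y∈whites)
                            (proj₁ (inner-bounds (proj₁ (∈-filter⁻ (T? ∘ K) y∈whites))))
    ... | inj₂ (here refl) = white<⇒⊏ white-1 white-n 2≤n
    ... | inj₂ (there y∈)  = white⊏black white-1 (∈blacks⇒black (Any.reverse⁻ y∈))

  length-S : length S ≡ n
  length-S = begin
      suc (length (whites ++ n ∷ reverse blacks))
    ≡⟨ cong suc (length-++ whites) ⟩
      suc (length whites + suc (length (reverse blacks)))
    ≡⟨ cong (λ l → suc (length whites + suc l)) (length-reverse blacks) ⟩
      suc (length whites + suc (length blacks))
    ≡⟨ cong suc (+-suc (length whites) (length blacks)) ⟩
      2 + (length whites + length blacks)
    ≡⟨ cong (2 +_) (length-filterᵇ-complement K (inner n)) ⟩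
      2 + length (inner n)
    ≡⟨ cong (2 +_) (trans (length-map (2 +_) (upTo (n ∸ 2))) (length-upTo (n ∸ 2))) ⟩
      2 + (n ∸ 2)
    ≡⟨ m+[n∸m]≡n 2≤n ⟩
      n ∎
    where open ≡-Reasoning

  nth-S-sorted : ∀ {t u} → t < u → u < n → nth S t ⊏ nth S u
  nth-S-sorted {u = u} t<u u<n = AllPairs-nth S S-sorted t<u (subst (u <_) (sym length-S) u<n)

  nth-S-injective : ∀ {t u} → t < n → u < n → nth S t ≡ nth S u → t ≡ u
  nth-S-injective {t} {u} t<n u<n eq with <-cmp t u
  ... | tri< t<u _ _ = contradiction (cong position eq) (<⇒≢ (nth-S-sorted t<u u<n))
  ... | tri≈ _ t≡u _ = t≡u
  ... | tri> _ _ u<t = contradiction (cong position (sym eq)) (<⇒≢ (nth-S-sorted u<t t<n))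

  index : ℕ → ℕ
  index x = indexOf x S

  index<n : ∀ {x} → Bead x → index x < n
  index<n {x} bx = subst (index x <_) length-S (proj₁ (indexOf-∈ S (bead∈S bx)))

  nth-index : ∀ {x} → Bead x → nth S (index x) ≡ x
  nth-index bx = proj₂ (indexOf-∈ S (bead∈S bx))

  index-mono : ∀ {x y} → Bead x → Bead y → x ⊏ y → index x < index y
  index-mono {x} {y} bx by x⊏y with <-cmp (index x) (index y)
  ... | tri< i<j _ _ = i<j
  ... | tri≈ _ i≡j _ =
    contradiction (cong position (trans (sym (nth-index bx)) (trans (cong (nth S) i≡j) (nth-index by))))
                  (<⇒≢ x⊏y)
  ... | tri> _ _ j<i =
    contradiction (subst₂ _⊏_ (nth-index by) (nth-index bx) (nth-S-sorted j<i (index<n bx))) (<-asym x⊏y)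

  nth-SS : ∀ {t} → t < n → nth (S ++ S) t ≡ nth S t
  nth-SS {t} t<n = nth-++ˡ S S (subst (t <_) (sym length-S) t<n)

  nth-SS-+n : ∀ t → nth (S ++ S) (t + n) ≡ nth S t
  nth-SS-+n t = begin
    nth (S ++ S) (t + n)          ≡⟨ cong (nth (S ++ S)) (trans (+-comm t n) (cong (_+ t) (sym length-S))) ⟩
    nth (S ++ S) (length S + t)   ≡⟨ nth-++ʳ S S t ⟩
    nth S t                       ∎
    where open ≡-Reasoning

  nth-SS-injective : ∀ {t p} → t < n + n → p < n → nth (S ++ S) t ≡ nth S p → t ≡ p ⊎ t ≡ p + n
  nth-SS-injective {t} {p} t<2n p<n eq with t <? n
  ... | yes t<n = inj₁ (nth-S-injective t<n p<n (trans (sym (nth-SS t<n)) eq))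
  ... | no  t≮n = inj₂ (trans (sym t∸n+n≡t) (cong (_+ n) t∸n≡p))
    where
    t∸n+n≡t : t ∸ n + n ≡ t
    t∸n+n≡t = m∸n+n≡m (≮⇒≥ t≮n)

    t∸n≡p : t ∸ n ≡ p
    t∸n≡p = nth-S-injective (subst (t ∸ n <_) (m+n∸n≡m n n) (∸-monoˡ-< t<2n (≮⇒≥ t≮n))) p<n
              (trans (sym (nth-SS-+n (t ∸ n))) (trans (cong (nth (S ++ S)) t∸n+n≡t) eq))

  arc-interval : ∀ {X} → IsArc n K X →
    Σ ℕ λ i → Σ ℕ λ m → i < n × (∀ {x} → Bead x → X x ⇔ InArc n i m (index x))
  arc-interval {X} (i , m , i<n , m≤n , X⇔) = i , m , i<n , λ bx → mk⇔ (to bx) (from bx)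
    where
    to : ∀ {x} → Bead x → X x → InArc n i m (index x)
    to {x} bx Xx with Equivalence.to (X⇔ x) Xx
    ... | j , j<m , eq =
      Sum.map (λ e → subst (InRange i (i + m)) e i+j∈) (λ e → subst (InRange i (i + m)) e i+j∈)
        (nth-SS-injective (+-mono-<-≤ i<n (<⇒≤ (<-≤-trans j<m m≤n))) (index<n bx)
          (trans eq (sym (nth-index bx))))
      where
      i+j∈ : InRange i (i + m) (i + j)
      i+j∈ = m≤m+n i j , +-monoʳ-< i j<m

    from : ∀ {x} → Bead x → InArc n i m (index x) → X x
    from {x} bx (inj₁ p∈) with InRange⇒offset p∈
    ... | j , j<m , i+j≡p = Equivalence.from (X⇔ x)
      (j , j<m , trans (cong (nth (S ++ S)) i+j≡p) (trans (nth-SS (index<n bx)) (nth-index bx)))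
    from {x} bx (inj₂ p+n∈) with InRange⇒offset p+n∈
    ... | j , j<m , i+j≡p+n = Equivalence.from (X⇔ x)
      (j , j<m , trans (cong (nth (S ++ S)) i+j≡p+n) (trans (nth-SS-+n (index x)) (nth-index bx)))

  arc-interleave₁ : ∀ {X w x y z} → IsArc n K X → Bead w → Bead x → Bead y → Bead z →
    w ⊏ x → x ⊏ y → y ⊏ z → X w → X y → X x ⊎ X z
  arc-interleave₁ arc bw bx by bz w⊏x x⊏y y⊏z Xw Xy with arc-interval arc
  ... | _ , _ , i<n , X⇔ = Sum.map (Equivalence.from (X⇔ bx)) (Equivalence.from (X⇔ bz))
    (InArc-interleave₁ i<n (index-mono bw bx w⊏x) (index-mono bx by x⊏y) (index-mono by bz y⊏z)
      (index<n bz) (Equivalence.to (X⇔ bw) Xw) (Equivalence.to (X⇔ by) Xy))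

  arc-interleave₂ : ∀ {X w x y z} → IsArc n K X → Bead w → Bead x → Bead y → Bead z →
    w ⊏ x → x ⊏ y → y ⊏ z → X x → X z → X w ⊎ X y
  arc-interleave₂ arc bw bx by bz w⊏x x⊏y y⊏z Xx Xz with arc-interval arc
  ... | _ , _ , i<n , X⇔ = Sum.map (Equivalence.from (X⇔ bw)) (Equivalence.from (X⇔ by))
    (InArc-interleave₂ i<n (index-mono bw bx w⊏x) (index-mono bx by x⊏y) (index-mono by bz y⊏z)
      (index<n bz) (Equivalence.to (X⇔ bx) Xx) (Equivalence.to (X⇔ bz) Xz))

  no-gap-on-both-sides : ∀ {X w a b c} → IsArc n K X → NoWhiteGap n K X →
    White n K w → Black n K a → 1 ≤ b → b < a → a < c → c ≤ n →
    X w → X a → ¬ X b → ¬ X c → ⊥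
  no-gap-on-both-sides {X} {w} {a} {b} {c} arc no-white-gap ww ba 1≤b b<a a<c c≤n Xw Xa b∉ c∉ =
    [ b-white , b-black ]′ (bead⇒white⊎black bb)
    where
    bb : Bead b
    bb = 1≤b , <⇒≤ (<-trans b<a (<-≤-trans a<c c≤n))

    bc : Bead c
    bc = ≤-trans 1≤b (<⇒≤ (<-trans b<a a<c)) , c≤n

    c-colour : White n K c ⊎ Black n K c
    c-colour = bead⇒white⊎black bc

    b<w : White n K b → b < w
    b<w wb with <-cmp b w
    ... | tri< b<w _ _ = b<w
    ... | tri≈ _ refl _ = contradiction Xw b∉
    ... | tri> _ _ w<b = ⊥-elim (no-white-gap w b a w<b b<a Xw Xa b∉ wb)

    w<c : White n K c → w < c
    w<c wc with <-cmp w c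
    ... | tri< w<c _ _ = w<c
    ... | tri≈ _ refl _ = contradiction Xw c∉
    ... | tri> _ _ c<w = ⊥-elim (no-white-gap a c w a<c c<w Xa Xw c∉ wc)

    w⊏c : White n K c ⊎ Black n K c → w ⊏ c
    w⊏c (inj₁ wc) = white<⇒⊏ ww wc (w<c wc)
    w⊏c (inj₂ bc) = white⊏black ww bc

    c⊏a : White n K c ⊎ Black n K c → c ⊏ a
    c⊏a (inj₁ wc) = white⊏black wc ba
    c⊏a (inj₂ bc) = black<⇒⊐ ba bc a<c

    b-black : Black n K b → ⊥
    b-black bb′ = [ c∉ , b∉ ]′ (arc-interleave₁ arc (white⇒bead ww) bc (black⇒bead ba) bb
      (w⊏c c-colour) (c⊏a c-colour) (black<⇒⊐ bb′ ba b<a) Xw Xa)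

    b-white : White n K b → ⊥
    b-white wb = [ b∉ , c∉ ]′ (arc-interleave₂ arc bb (white⇒bead ww) bc (black⇒bead ba)
      (white<⇒⊏ wb ww (b<w wb)) (w⊏c c-colour) (c⊏a c-colour) Xw Xa)

  head-white : ∀ {w xs} → InD n K (w ∷ xs) → White n K w
  head-white {w} D = [ id , top-black ]′ (bead⇒white⊎black (InD-bounds D (here refl)))
    where
    top-black : Black n K w → White n K w
    top-black bw = ⊥-elim (singleton-black-not-wconvex bw (prefix-wconvex [ w ] D (s≤s z≤n)))

  black-not-first : ∀ {a b c xs} → Black n K a → 1 ≤ b → b < a → a < c → c ≤ n →
    InD n K xs → ¬ RanksFirst xs a b c
  black-not-first {a} ba _ _ _ _ D ([] , _ , refl , _ , _) =
    singleton-black-not-wconvex ba (prefix-wconvex [ a ] D (s≤s z≤n))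
  black-not-first {a} {b} {c} ba 1≤b b<a a<c c≤n D (w ∷ ys , zs , refl , b∈zs , c∈zs) =
    no-gap-on-both-sides (proj₁ X-wconvex) (proj₂ (proj₂ X-wconvex)) (head-white D) ba 1≤b b<a a<c c≤n
      (here refl) (∈-++⁺ʳ (w ∷ ys) (here refl)) (not-above b∈zs (<⇒≢ b<a)) (not-above c∈zs (>⇒≢ a<c))
    where
    X-wconvex : WConvex n K (_∈ w ∷ ys ++ [ a ])
    X-wconvex = prefix-wconvex (w ∷ ys ++ [ a ])
      (subst (InD n K) (sym (++-assoc (w ∷ ys) [ a ] zs)) D) (s≤s z≤n)

    not-above : ∀ {y} → y ∈ zs → y ≢ a → ¬ y ∈ w ∷ ys ++ [ a ]
    not-above y∈zs y≢a y∈ with ∈-++⁻ (w ∷ ys) y∈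
    ... | inj₁ y∈ys        = Unique-++-disjoint (w ∷ ys) (InD-unique D) y∈ys (there y∈zs)
    ... | inj₂ (here y≡a) = y≢a y≡a

lemma1 : (n : ℕ) → 3 ≤ n → (K : ℕ → Bool) →
    ((a b c : ℕ) → Black n K a → 1 ≤ b → b < a → a < c → c ≤ n →
      (xs : List ℕ) → InD n K xs → ¬ RanksFirst xs a b c)
    × ((a b c : ℕ) → White n K a → 1 ≤ b → b < a → a < c → c ≤ n →
      (xs : List ℕ) → InD n K xs → ¬ RanksLast xs a b c)
lemma1 n 3≤n K =
  (λ a b c ba 1≤b b<a a<c c≤n xs → black-not-first ba 1≤b b<a a<c c≤n) ,
  (λ a b c wa _ b<a a<c _ xs → white-not-last wa b<a a<c)
  where open Necklace n (<⇒≤ 3≤n) K
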